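{- Let $x\neq0$ be a complex number and let $(\sigma_n)_{n\ge 0}$ be defined by $\sigma_0=3$, $\sigma_1=2x$, $\sigma_2=4x^2$ and $\sigma_n=2x\,\sigma_{n-1}+\sigma_{n-3}$ for $n\ge 3$. Let $t$ be a complex number with $x^3(1-t)^2(1+t)=-1$, let $W$ be a square root of $(1+t)(5-3t)$, and put $$w_1=1-t,\qquad w_2=\frac{1+t-W}{2},\qquad w_3=\frac{1+t+W}{2}.$$ Then for all $n\ge 0$, $$\sigma_n=x^n\big(w_1^n+w_2^n+w_3^n\big).$$
   Context: This is the third version of the third-order Pell polynomials of Mahon and Horadam. -}

module Defs where

open import Algebra.Bundles using (CommutativeRing)
open import Data.Nat using (ℕ; zero; suc)

module _ {c ℓ} (R : CommutativeRing c ℓ) where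
  open CommutativeRing R

  pow : Carrier → ℕ → Carrier
  pow a zero = 1#
  pow a (suc n) = a * pow a n

  two three four five : Carrier
  two = 1# + 1#
  three = two + 1#
  four = two + two
  five = four + 1#

  σ : Carrier → ℕ → Carrier
  σ x zero = three
  σ x (suc zero) = two * x
  σ x (suc (suc zero)) = four * pow x 2
  σ x (suc (suc (suc n))) = two * x * σ x (suc (suc n)) + σ x n

{-# OPTIONS --safe #-}
module Submission where

-- w₂ and w₃ are the roots of y² − (1+t)y − (1+t)w₁ given by the quadratic formula, so the
-- elementary symmetric functions of (w₁, w₂, w₃) are 2, 0 and −w₁²(1+t). Since
-- x³w₁²(1+t) = −1, the xwᵢ are then the roots of y³ − 2xy² − 1, and Newton's identities
-- give their power sums the recurrence of σ, with initial values 3, e₁ = 2x and e₁² − 2e₂ = 4x².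

open import Defs
open import Algebra.Bundles using (CommutativeRing)
open import Data.Nat using (ℕ; zero; suc)
open import Relation.Nullary using (¬_)

module _ {c ℓ} (R : CommutativeRing c ℓ) where

  open CommutativeRing R
  open import Algebra.Solver.Ring.NaturalCoefficients.Default commutativeSemiring
  open import Relation.Binary.Reasoning.Setoid setoid
  open import Algebra.Properties.Ring ring using (-‿distribʳ-*)
  open import Algebra.Properties.Group +-group using (∙-cancelʳ; inverseˡ-unique; ⁻¹-involutive)

  pow-distrib-* : ∀ x y n → pow R (x * y) n ≈ pow R x n * pow R y n
  pow-distrib-* x y zero = sym (*-identityˡ 1#)
  pow-distrib-* x y (suc n) = begin
    x * y * pow R (x * y) n           ≈⟨ *-congˡ (pow-distrib-* x y n) ⟩
    x * y * (pow R x n * pow R y n)   ≈⟨ solve 4 (λ x y p q → x :* y :* (p :* q) := x :* p :* (y :* q)) refl x y (pow R x n) (pow R y n) ⟩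
    x * pow R x n * (y * pow R y n)   ∎

  powerSum₃ : Carrier → Carrier → Carrier → ℕ → Carrier
  powerSum₃ u v w n = pow R u n + pow R v n + pow R w n

  powerSum₃-scale : ∀ x u v w n → powerSum₃ (x * u) (x * v) (x * w) n ≈ pow R x n * powerSum₃ u v w n
  powerSum₃-scale x u v w n = begin
    powerSum₃ (x * u) (x * v) (x * w) n
      ≈⟨ +-cong (+-cong (pow-distrib-* x u n) (pow-distrib-* x v n)) (pow-distrib-* x w n) ⟩
    pow R x n * pow R u n + pow R x n * pow R v n + pow R x n * pow R w n
      ≈⟨ solve 4 (λ p q r s → p :* q :+ p :* r :+ p :* s := p :* (q :+ r :+ s)) refl (pow R x n) (pow R u n) (pow R v n) (pow R w n) ⟩
    pow R x n * powerSum₃ u v w n ∎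

  -- Newton's identity for three variables, with the negative terms moved across so that it is a semiring identity.
  powerSum₃-newton : ∀ u v w n →
    powerSum₃ u v w (suc (suc (suc n))) + (u * v + u * w + v * w) * powerSum₃ u v w (suc n)
      ≈ (u + v + w) * powerSum₃ u v w (suc (suc n)) + u * v * w * powerSum₃ u v w n
  powerSum₃-newton u v w n = solve 6
    (λ u v w p q r →
      u :* (u :* (u :* p)) :+ v :* (v :* (v :* q)) :+ w :* (w :* (w :* r))
        :+ (u :* v :+ u :* w :+ v :* w) :* (u :* p :+ v :* q :+ w :* r)
      := (u :+ v :+ w) :* (u :* (u :* p) :+ v :* (v :* q) :+ w :* (w :* r))
        :+ u :* v :* w :* (p :+ q :+ r))
    refl u v w (pow R u n) (pow R v n) (pow R w n)

  σ-powerSum₃ : ∀ x u v w →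
    u + v + w ≈ two R * x → u * v + u * w + v * w ≈ 0# → u * v * w ≈ 1# →
    ∀ n → σ R x n ≈ powerSum₃ u v w n
  σ-powerSum₃ x u v w e₁≈2x e₂≈0 e₃≈1 = go
    where
    p : ℕ → Carrier
    p = powerSum₃ u v w

    e₁ e₂ : Carrier
    e₁ = u + v + w
    e₂ = u * v + u * w + v * w

    recurrence : ∀ n → p (suc (suc (suc n))) ≈ two R * x * p (suc (suc n)) + p n
    recurrence n = begin
      p (suc (suc (suc n)))                  ≈⟨ +-identityʳ _ ⟨
      p (suc (suc (suc n))) + 0#             ≈⟨ +-congˡ (zeroˡ _) ⟨
      p (suc (suc (suc n))) + 0# * p (suc n) ≈⟨ +-congˡ (*-congʳ e₂≈0) ⟨
      p (suc (suc (suc n))) + e₂ * p (suc n) ≈⟨ powerSum₃-newton u v w n ⟩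
      e₁ * p (suc (suc n)) + u * v * w * p n ≈⟨ +-cong (*-congʳ e₁≈2x) (trans (*-congʳ e₃≈1) (*-identityˡ _)) ⟩
      two R * x * p (suc (suc n)) + p n      ∎

    go : ∀ n → σ R x n ≈ p n
    go zero = refl
    go (suc zero) = sym (begin
      u * 1# + v * 1# + w * 1# ≈⟨ solve 3 (λ u v w → u :* con 1 :+ v :* con 1 :+ w :* con 1 := u :+ v :+ w) refl u v w ⟩
      e₁                       ≈⟨ e₁≈2x ⟩
      two R * x                ∎)
    go (suc (suc zero)) = sym (begin
      p 2                              ≈⟨ +-identityʳ _ ⟨
      p 2 + 0#                         ≈⟨ +-congˡ (zeroʳ _) ⟨
      p 2 + two R * 0#                 ≈⟨ +-congˡ (*-congˡ e₂≈0) ⟨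
      p 2 + two R * e₂                 ≈⟨ solve 3 (λ u v w →
                                            u :* (u :* con 1) :+ v :* (v :* con 1) :+ w :* (w :* con 1)
                                              :+ (con 1 :+ con 1) :* (u :* v :+ u :* w :+ v :* w)
                                            := (u :+ v :+ w) :* (u :+ v :+ w)) refl u v w ⟩
      e₁ * e₁                          ≈⟨ *-cong e₁≈2x e₁≈2x ⟩
      two R * x * (two R * x)          ≈⟨ solve 1 (λ x →
                                            (con 1 :+ con 1) :* x :* ((con 1 :+ con 1) :* x)
                                            := ((con 1 :+ con 1) :+ (con 1 :+ con 1)) :* (x :* (x :* con 1))) refl x ⟩
      four R * pow R x 2               ∎)
    go (suc (suc (suc n))) = begin
      two R * x * σ R x (suc (suc n)) + σ R x n ≈⟨ +-cong (*-congˡ (go (suc (suc n)))) (go n) ⟩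
      two R * x * p (suc (suc n)) + p n         ≈⟨ recurrence n ⟨
      p (suc (suc (suc n)))                     ∎

  σ-scaledPowerSum₃ : ∀ x u v w →
    u + v + w ≈ two R → u * v + u * w + v * w ≈ 0# → pow R x 3 * (u * v * w) ≈ 1# →
    ∀ n → σ R x n ≈ pow R x n * powerSum₃ u v w n
  σ-scaledPowerSum₃ x u v w e₁≈2 e₂≈0 x³e₃≈1 n = begin
    σ R x n                             ≈⟨ σ-powerSum₃ x (x * u) (x * v) (x * w) scaled-e₁ scaled-e₂ scaled-e₃ n ⟩
    powerSum₃ (x * u) (x * v) (x * w) n ≈⟨ powerSum₃-scale x u v w n ⟩
    pow R x n * powerSum₃ u v w n       ∎
    where
    scaled-e₁ : x * u + x * v + x * w ≈ two R * x
    scaled-e₁ = trans (solve 4 (λ x u v w → x :* u :+ x :* v :+ x :* w := (u :+ v :+ w) :* x) refl x u v w)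
                      (*-congʳ e₁≈2)

    scaled-e₂ : x * u * (x * v) + x * u * (x * w) + x * v * (x * w) ≈ 0#
    scaled-e₂ = begin
      x * u * (x * v) + x * u * (x * w) + x * v * (x * w) ≈⟨ solve 4 (λ x u v w →
                                                               x :* u :* (x :* v) :+ x :* u :* (x :* w) :+ x :* v :* (x :* w)
                                                               := x :* x :* (u :* v :+ u :* w :+ v :* w)) refl x u v w ⟩
      x * x * (u * v + u * w + v * w)                     ≈⟨ *-congˡ e₂≈0 ⟩
      x * x * 0#                                          ≈⟨ zeroʳ _ ⟩
      0#                                                  ∎

    scaled-e₃ : x * u * (x * v) * (x * w) ≈ 1#
    scaled-e₃ = trans (solve 4 (λ x u v w → x :* u :* (x :* v) :* (x :* w) := x :* (x :* (x :* con 1)) :* (u :* v :* w)) refl x u v w)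
                      x³e₃≈1

  difference-of-squares : ∀ p q → (p - q) * (p + q) + q * q ≈ p * p
  difference-of-squares p q = begin
    (p - q) * (p + q) + q * q ≈⟨ solve 3 (λ p q m → (p :+ m) :* (p :+ q) :+ q :* q := p :* p :+ (p :+ q) :* (m :+ q)) refl p q (- q) ⟩
    p * p + (p + q) * (- q + q) ≈⟨ +-congˡ (*-congˡ (-‿inverseˡ q)) ⟩
    p * p + (p + q) * 0#        ≈⟨ +-congˡ (zeroʳ _) ⟩
    p * p + 0#                  ≈⟨ +-identityʳ _ ⟩
    p * p                       ∎

  module _ (h : Carrier) (h*2≈1 : h * two R ≈ 1#) where

    quadraticRoots-sum : ∀ p W → h * (p - W) + h * (p + W) ≈ p
    quadraticRoots-sum p W = begin
      h * (p - W) + h * (p + W)        ≈⟨ solve 4 (λ h p m W → h :* (p :+ m) :+ h :* (p :+ W) := h :* (con 1 :+ con 1) :* p :+ h :* (m :+ W)) refl h p (- W) W ⟩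
      h * two R * p + h * (- W + W)    ≈⟨ +-cong (*-congʳ h*2≈1) (*-congˡ (-‿inverseˡ W)) ⟩
      1# * p + h * 0#                  ≈⟨ +-cong (*-identityˡ p) (zeroʳ h) ⟩
      p + 0#                           ≈⟨ +-identityʳ p ⟩
      p                                ∎

    quadraticRoots-product : ∀ p q W → W * W ≈ p * p + four R * q → h * (p - W) * (h * (p + W)) + q ≈ 0#
    quadraticRoots-product p q W W²≈disc = begin
      h * (p - W) * (h * (p + W)) + q                  ≈⟨ +-congˡ (*-identityˡ q) ⟨
      h * (p - W) * (h * (p + W)) + 1# * q             ≈⟨ +-congˡ (*-congʳ (trans (*-cong h*2≈1 h*2≈1) (*-identityˡ 1#))) ⟨
      h * (p - W) * (h * (p + W)) + h * two R * (h * two R) * q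
                                                       ≈⟨ solve 4 (λ h d1 d2 q →
                                                            h :* d1 :* (h :* d2) :+ h :* (con 1 :+ con 1) :* (h :* (con 1 :+ con 1)) :* q
                                                            := h :* h :* (d1 :* d2 :+ ((con 1 :+ con 1) :+ (con 1 :+ con 1)) :* q)) refl h (p - W) (p + W) q ⟩
      h * h * ((p - W) * (p + W) + four R * q)         ≈⟨ *-congˡ D+4q≈0 ⟩
      h * h * 0#                                       ≈⟨ zeroʳ _ ⟩
      0#                                               ∎
      where
      D+4q≈0 : (p - W) * (p + W) + four R * q ≈ 0#
      D+4q≈0 = ∙-cancelʳ (p * p) _ _ (begin
        (p - W) * (p + W) + four R * q + p * p ≈⟨ solve 3 (λ d q p → d :+ q :+ p := d :+ (p :+ q)) refl ((p - W) * (p + W)) (four R * q) (p * p) ⟩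
        (p - W) * (p + W) + (p * p + four R * q) ≈⟨ +-congˡ W²≈disc ⟨
        (p - W) * (p + W) + W * W              ≈⟨ difference-of-squares p W ⟩
        p * p                                  ≈⟨ +-identityˡ _ ⟨
        0# + p * p                             ∎)

  module PellRoots (h : Carrier) (h*2≈1 : h * two R ≈ 1#)
    (t W : Carrier) (W² : W * W ≈ (1# + t) * (five R - three R * t)) where

    s w₁ w₂ w₃ : Carrier
    s = 1# + t
    w₁ = 1# - t
    w₂ = h * (s - W)
    w₃ = h * (s + W)

    w₁+s≈2 : w₁ + s ≈ two R
    w₁+s≈2 = begin
      1# - t + (1# + t)         ≈⟨ solve 2 (λ t m → con 1 :+ m :+ (con 1 :+ t) := (con 1 :+ con 1) :+ (m :+ t)) refl t (- t) ⟩
      two R + (- t + t)         ≈⟨ +-congˡ (-‿inverseˡ t) ⟩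
      two R + 0#                ≈⟨ +-identityʳ _ ⟩
      two R                     ∎

    W²≈disc : W * W ≈ s * s + four R * (s * w₁)
    W²≈disc = begin
      W * W                                           ≈⟨ W² ⟩
      s * (four R + 1# - three R * t)                 ≈⟨ *-congˡ (+-congˡ (-‿distribʳ-* (three R) t)) ⟩
      s * (four R + 1# + three R * - t)               ≈⟨ *-congˡ (+-identityʳ _) ⟨
      s * (four R + 1# + three R * - t + 0#)          ≈⟨ *-congˡ (+-congˡ (-‿inverseˡ t)) ⟨
      s * (four R + 1# + three R * - t + (- t + t))   ≈⟨ solve 2 (λ t m →
                                                           (con 1 :+ t) :* ((con 1 :+ con 1) :+ (con 1 :+ con 1) :+ con 1
                                                               :+ ((con 1 :+ con 1) :+ con 1) :* m :+ (m :+ t))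
                                                           := (con 1 :+ t) :* (con 1 :+ t)
                                                               :+ ((con 1 :+ con 1) :+ (con 1 :+ con 1)) :* ((con 1 :+ t) :* (con 1 :+ m))) refl t (- t) ⟩
      s * s + four R * (s * w₁)                       ∎

    w₂+w₃≈s : w₂ + w₃ ≈ s
    w₂+w₃≈s = quadraticRoots-sum h h*2≈1 s W

    w₂w₃+sw₁≈0 : w₂ * w₃ + s * w₁ ≈ 0#
    w₂w₃+sw₁≈0 = quadraticRoots-product h h*2≈1 s (s * w₁) W W²≈disc

    roots-sum : w₁ + w₂ + w₃ ≈ two R
    roots-sum = begin
      w₁ + w₂ + w₃   ≈⟨ +-assoc w₁ w₂ w₃ ⟩
      w₁ + (w₂ + w₃) ≈⟨ +-congˡ w₂+w₃≈s ⟩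
      w₁ + s         ≈⟨ w₁+s≈2 ⟩
      two R          ∎

    roots-pairProducts : w₁ * w₂ + w₁ * w₃ + w₂ * w₃ ≈ 0#
    roots-pairProducts = begin
      w₁ * w₂ + w₁ * w₃ + w₂ * w₃ ≈⟨ solve 3 (λ a b c → a :* b :+ a :* c :+ b :* c := b :* c :+ (b :+ c) :* a) refl w₁ w₂ w₃ ⟩
      w₂ * w₃ + (w₂ + w₃) * w₁    ≈⟨ +-congˡ (*-congʳ w₂+w₃≈s) ⟩
      w₂ * w₃ + s * w₁            ≈⟨ w₂w₃+sw₁≈0 ⟩
      0#                          ∎

    roots-product : ∀ x → pow R x 3 * (pow R w₁ 2 * s) ≈ - 1# → pow R x 3 * (w₁ * w₂ * w₃) ≈ 1#
    roots-product x cubic = begin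
      pow R x 3 * (w₁ * w₂ * w₃)           ≈⟨ inverseˡ-unique _ _ sum≈0 ⟩
      - (pow R x 3 * (pow R w₁ 2 * s))     ≈⟨ -‿cong cubic ⟩
      - - 1#                               ≈⟨ ⁻¹-involutive 1# ⟩
      1#                                   ∎
      where
      sum≈0 : pow R x 3 * (w₁ * w₂ * w₃) + pow R x 3 * (pow R w₁ 2 * s) ≈ 0#
      sum≈0 = begin
        pow R x 3 * (w₁ * w₂ * w₃) + pow R x 3 * (pow R w₁ 2 * s) ≈⟨ solve 5 (λ x a b c s →
                                                                       x :* (a :* b :* c) :+ x :* (a :* (a :* con 1) :* s)
                                                                       := x :* a :* (b :* c :+ s :* a)) refl (pow R x 3) w₁ w₂ w₃ s ⟩
        pow R x 3 * w₁ * (w₂ * w₃ + s * w₁)                        ≈⟨ *-congˡ w₂w₃+sw₁≈0 ⟩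
        pow R x 3 * w₁ * 0#                                         ≈⟨ zeroʳ _ ⟩
        0#                                                          ∎

mainTheorem6 : ∀ {c ℓ} (R : CommutativeRing c ℓ) → let open CommutativeRing R in
    (half : Carrier) → half * two R ≈ 1# →
    (x : Carrier) → ¬ (x ≈ 0#) →
    (t : Carrier) → pow R x 3 * (pow R (1# - t) 2 * (1# + t)) ≈ - 1# →
    (W : Carrier) → W * W ≈ (1# + t) * (five R - three R * t) →
    (n : ℕ) →
    σ R x n ≈ pow R x n * (pow R (1# - t) n + pow R (half * (1# + t - W)) n + pow R (half * (1# + t + W)) n)
mainTheorem6 R half half*2≈1 x _ t cubic W W² =
  σ-scaledPowerSum₃ R x w₁ w₂ w₃ roots-sum roots-pairProducts (roots-product x cubic)
  where open PellRoots R half half*2≈1 t W W²
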